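{- Let $p \geq 5$ be a prime number such that the polynomial $X^3-X-1$ has fewer than $3$ distinct roots in $\mathbb{F}_p$. A $\Phi_{3}$-sequence $(a_n)_{n\in\mathbb{Z}}$ in $\mathbb{F}_p$ is a complete Padovan sequence if and only if $a_n=b^n$ for all $n$, where $b$ is a Padovan primitive root.
   Context: For a prime $p\ge 5$ and $\kappa\in\{2,\dots,p-2\}$, a sequence $(a_n)_{n\in\mathbb{Z}}$ of elements of $\mathbb{F}_p$ is a $\Phi_\kappa$-sequence if $a_0=1$ and $a_{n+\kappa}=a_n+a_{n+1}$ in $\mathbb{F}_p$ for all $n\in\mathbb{Z}$. It is complete if it is periodic with period $p-1$ and $\{a_1,\dots,a_{p-2}\}=\{2,\dots,p-1\}$. A complete $\Phi_3$-sequence is called a complete Padovan sequence. A Padovan primitive root is a primitive root $b$ mod $p$ (viewed in $\mathbb{F}_p$) satisfying $b^3=b+1$. -}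

module Defs where

open import Data.Nat as ℕ using (ℕ; zero; suc; NonZero; _≤_; _∸_)
open import Data.Nat.DivMod using (_mod_)
open import Data.Fin using (Fin; toℕ)
open import Data.Integer as ℤ using (ℤ; +_; -[1+_])
open import Data.Product using (Σ; _×_; _,_)
open import Relation.Binary.PropositionalEquality using (_≡_; _≢_)
open import Relation.Nullary using (¬_)

𝔽 : ℕ → Set
𝔽 p = Fin p

module _ (p : ℕ) .{{_ : NonZero p}} where

  zeroF : 𝔽 p
  zeroF = 0 mod p

  oneF : 𝔽 p
  oneF = 1 mod p

  addF : 𝔽 p → 𝔽 p → 𝔽 p
  addF x y = (toℕ x ℕ.+ toℕ y) mod p

  mulF : 𝔽 p → 𝔽 p → 𝔽 p
  mulF x y = (toℕ x ℕ.* toℕ y) mod p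

  powF : 𝔽 p → ℕ → 𝔽 p
  powF b zero = oneF
  powF b (suc k) = mulF b (powF b k)

  IsPadovanRoot : 𝔽 p → Set
  IsPadovanRoot b = powF b 3 ≡ addF b oneF

  FewerThan3Roots : Set
  FewerThan3Roots =
    ¬ (Σ (𝔽 p) λ x → Σ (𝔽 p) λ y → Σ (𝔽 p) λ z →
         IsPadovanRoot x × IsPadovanRoot y × IsPadovanRoot z ×
         x ≢ y × x ≢ z × y ≢ z)

  IsPrimitiveRoot : 𝔽 p → Set
  IsPrimitiveRoot b =
    b ≢ zeroF × powF b (p ∸ 1) ≡ oneF ×
    (∀ k → 1 ≤ k → k ℕ.< p ∸ 1 → powF b k ≢ oneF)

  IsPadovanPrimitiveRoot : 𝔽 p → Set
  IsPadovanPrimitiveRoot b = IsPrimitiveRoot b × IsPadovanRoot b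

  IsΦSeq : ℕ → (ℤ → 𝔽 p) → Set
  IsΦSeq κ a = a (+ 0) ≡ oneF × (∀ n → a (n ℤ.+ + κ) ≡ addF (a n) (a (n ℤ.+ + 1)))

  -- complete: periodic with period p - 1 and {a_1,…,a_{p-2}} = {2,…,p-1}
  IsComplete : (ℤ → 𝔽 p) → Set
  IsComplete a =
    (∀ n → a (n ℤ.+ + (p ∸ 1)) ≡ a n) ×
    (∀ i → 1 ≤ i → i ≤ p ∸ 2 → 2 ≤ toℕ (a (+ i))) ×
    (∀ (y : 𝔽 p) → 2 ≤ toℕ y → Σ ℕ λ i → 1 ≤ i × i ≤ p ∸ 2 × a (+ i) ≡ y)

  IsCompletePadovan : (ℤ → 𝔽 p) → Set
  IsCompletePadovan a = IsΦSeq 3 a × IsComplete a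

  -- a_n = b^n for all n ∈ ℤ; for n = -m < 0, b^n is the inverse of b^m,
  -- expressed as a_n · b^m = 1.
  IsPowerSeq : (ℤ → 𝔽 p) → 𝔽 p → Set
  IsPowerSeq a b =
    (∀ (k : ℕ) → a (+ k) ≡ powF b k) ×
    (∀ (k : ℕ) → mulF (a -[1+ k ]) (powF b (suc k)) ≡ oneF)

module Submission where

-- Let α(n) = a_n for n ≥ 0 and N = p - 1. The resolvents R_c(n) = Σ_{k<N} c^(N-k) α(n+k), c ∈ 𝔽ₚ,
-- satisfy R_c(n+1) = c R_c(n) (Fermat and N-periodicity) and the Padovan recurrence, so R_c ≠ 0
-- only for roots c of X³ - X - 1; and Σ_c R_c(n) = -α(n), as Σ_x x^j is 0 for j < N and -1 for j = N.
-- Two distinct roots r, s force the third root -(r + s), distinct from both unless p = 23, so with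
-- fewer than three roots a single resolvent survives and α(n) = r^n; completeness of α then says
-- exactly that r is a primitive root. For p = 23, where X³ - X - 1 = (X - 10)²(X - 3), the starts
-- (a₁, a₂) are checked exhaustively. Conversely, powers of a primitive root are (p-1)-periodic and
-- run through 𝔽ₚ^×.

open import Algebra.Bundles using (CommutativeRing; CommutativeSemiring)
open import Data.Nat as ℕ using (ℕ; zero; suc; _∸_)
import Data.Nat.Properties as ℕₚ
open import Data.Nat.Primality using (Prime; euclidsLemma)
open import Data.Product using (_,_)
open import Level using (0ℓ)
open import Relation.Binary.PropositionalEquality as ≡ using (_≡_; _≢_; cong)
open import Relation.Nullary using (yes; no; contradiction)

module IntegerCoefficients {c ℓ} (R : CommutativeRing c ℓ) where

  open import Data.Integer as ℤ using (ℤ; +_; -[1+_]; _⊖_)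
  import Data.Integer.Properties as ℤ
  import Data.Maybe as Maybe
  open import Data.Sign as Sign using (Sign)
  open import Relation.Nullary.Decidable.Core using (dec⇒maybe)

  open CommutativeRing R
  open import Algebra.Properties.Ring ring using (-‿involutive; -0#≈0#; -1*x≈-x)
  open import Algebra.Properties.AbelianGroup +-abelianGroup using (⁻¹-∙-comm)
  open import Algebra.Properties.CommutativeSemigroup +-commutativeSemigroup
    using () renaming (interchange to +-interchange)
  open import Algebra.Properties.CommutativeSemigroup *-commutativeSemigroup
    using () renaming (interchange to *-interchange)
  open import Algebra.Properties.Semiring.Mult.TCOptimised semiring using (_×_; ×-homo-+; ×1-homo-*)
  open import Algebra.Solver.Ring.AlmostCommutativeRing
    using (fromCommutativeRing; _-Raw-AlmostCommutative⟶_)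
  open import Relation.Binary.Reasoning.Setoid setoid

  -- The optimised _×_ gives fromℤ (+ 1) = 1# definitionally, so that the solver's
  -- constant 1 is the ring's 1# on the nose.
  fromℤ : ℤ → Carrier
  fromℤ (+ n)    = n × 1#
  fromℤ -[1+ n ] = - (suc n × 1#)

  private
    sign : Sign → Carrier
    sign Sign.+ = 1#
    sign Sign.- = - 1#

    sign-* : ∀ s t → sign (s Sign.* t) ≈ sign s * sign t
    sign-* Sign.+ t      = sym (*-identityˡ _)
    sign-* Sign.- Sign.+ = sym (*-identityʳ _)
    sign-* Sign.- Sign.- = begin
      1#          ≈⟨ -‿involutive 1# ⟨
      - (- 1#)    ≈⟨ -1*x≈-x (- 1#) ⟨
      - 1# * - 1# ∎

    fromℤ-◃ : ∀ s n → fromℤ (s ℤ.◃ n) ≈ sign s * (n × 1#)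
    fromℤ-◃ s      zero    = sym (zeroʳ _)
    fromℤ-◃ Sign.+ (suc n) = sym (*-identityˡ _)
    fromℤ-◃ Sign.- (suc n) = sym (-1*x≈-x _)

    fromℤ-signAbs : ∀ i → fromℤ i ≈ sign (ℤ.sign i) * (ℤ.∣ i ∣ × 1#)
    fromℤ-signAbs (+ n)    = sym (*-identityˡ _)
    fromℤ-signAbs -[1+ n ] = sym (-1*x≈-x _)

  fromℤ-⊖ : ∀ m n → fromℤ (m ⊖ n) ≈ m × 1# - n × 1#
  fromℤ-⊖ m       zero    = begin
    fromℤ (m ⊖ 0)   ≡⟨ cong fromℤ (ℤ.⊖-≥ {m} ℕ.z≤n) ⟩
    m × 1#          ≈⟨ +-identityʳ _ ⟨
    m × 1# + 0#     ≈⟨ +-congˡ -0#≈0# ⟨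
    m × 1# - 0#     ∎
  fromℤ-⊖ zero    (suc n) = begin
    fromℤ (0 ⊖ suc n) ≡⟨ cong fromℤ (ℤ.⊖-< {0} {suc n} (ℕ.s≤s ℕ.z≤n)) ⟩
    - (suc n × 1#)    ≈⟨ +-identityˡ _ ⟨
    0# - suc n × 1#   ∎
  fromℤ-⊖ (suc m) (suc n) = begin
    fromℤ (suc m ⊖ suc n)
      ≡⟨ cong fromℤ (ℤ.[1+m]⊖[1+n]≡m⊖n m n) ⟩
    fromℤ (m ⊖ n)
      ≈⟨ fromℤ-⊖ m n ⟩
    m × 1# - n × 1#
      ≈⟨ +-identityˡ _ ⟨
    0# + (m × 1# - n × 1#)
      ≈⟨ +-congʳ (-‿inverseʳ 1#) ⟨
    (1# - 1#) + (m × 1# - n × 1#)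
      ≈⟨ +-interchange 1# (- 1#) (m × 1#) (- (n × 1#)) ⟩
    (1# + m × 1#) + (- 1# - n × 1#)
      ≈⟨ +-congˡ (⁻¹-∙-comm 1# (n × 1#)) ⟩
    (1# + m × 1#) - (1# + n × 1#)
      ≈⟨ +-cong (×-homo-+ 1# 1 m) (-‿cong (×-homo-+ 1# 1 n)) ⟨
    suc m × 1# - suc n × 1# ∎

  fromℤ-+ : ∀ i j → fromℤ (i ℤ.+ j) ≈ fromℤ i + fromℤ j
  fromℤ-+ (+ m)    (+ n)    = ×-homo-+ 1# m n
  fromℤ-+ (+ m)    -[1+ n ] = fromℤ-⊖ m (suc n)
  fromℤ-+ -[1+ m ] (+ n)    = trans (fromℤ-⊖ n (suc m)) (+-comm _ _)
  fromℤ-+ -[1+ m ] -[1+ n ] = begin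
    - (suc (suc (m ℕ.+ n)) × 1#)       ≡⟨ cong (λ k → - (suc k × 1#)) (ℕₚ.+-suc m n) ⟨
    - ((suc m ℕ.+ suc n) × 1#)         ≈⟨ -‿cong (×-homo-+ 1# (suc m) (suc n)) ⟩
    - (suc m × 1# + suc n × 1#)        ≈⟨ ⁻¹-∙-comm _ _ ⟨
    - (suc m × 1#) + - (suc n × 1#)    ∎

  fromℤ-* : ∀ i j → fromℤ (i ℤ.* j) ≈ fromℤ i * fromℤ j
  fromℤ-* i j = begin
    fromℤ (i ℤ.* j)                                ≈⟨ fromℤ-◃ (s Sign.* t) (m ℕ.* n) ⟩
    sign (s Sign.* t) * ((m ℕ.* n) × 1#)            ≈⟨ *-cong (sign-* s t) (×1-homo-* m n) ⟩
    (sign s * sign t) * ((m × 1#) * (n × 1#))       ≈⟨ *-interchange _ _ _ _ ⟩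
    (sign s * (m × 1#)) * (sign t * (n × 1#))       ≈⟨ *-cong (fromℤ-signAbs i) (fromℤ-signAbs j) ⟨
    fromℤ i * fromℤ j                              ∎
    where
    s t : Sign
    s = ℤ.sign i
    t = ℤ.sign j
    m n : ℕ
    m = ℤ.∣ i ∣
    n = ℤ.∣ j ∣

  homomorphism : ℤ.+-*-rawRing -Raw-AlmostCommutative⟶ fromCommutativeRing R
  homomorphism = record
    { ⟦_⟧    = fromℤ
    ; +-homo = fromℤ-+
    ; *-homo = fromℤ-*
    ; -‿homo = fromℤ-neg
    ; 0-homo = refl
    ; 1-homo = refl
    }
    where
    fromℤ-neg : ∀ i → fromℤ (ℤ.- i) ≈ - fromℤ i
    fromℤ-neg -[1+ n ]    = sym (-‿involutive _)
    fromℤ-neg (+ zero)    = sym -0#≈0#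
    fromℤ-neg (+ (suc n)) = refl

  open import Algebra.Solver.Ring ℤ.+-*-rawRing (fromCommutativeRing R) homomorphism
    (λ i j → Maybe.map (λ i≡j → reflexive (cong fromℤ i≡j)) (dec⇒maybe (i ℤ.≟ j)))
    public

module _ {c ℓ} (S : CommutativeSemiring c ℓ) where

  open CommutativeSemiring S
  open import Algebra.Properties.CommutativeSemiring.Binomial S using (theorem)
  open import Algebra.Properties.Semiring.Sum semiring
    using (sum; sum-init-last; sum-cong-≋; sum-cong-≗; sum-replicate-zero)
  open import Algebra.Properties.Semiring.Mult semiring using (_×_; ×-congʳ; ×-assoc-*)
  open import Algebra.Properties.Semiring.Exp semiring using (_^_)
  open import Data.Fin using (Fin; toℕ; fromℕ; inject₁) renaming (zero to 0F; suc to 1+_)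
  open import Data.Fin.Properties using (toℕ-fromℕ; toℕ-inject₁; toℕ<n; suc-injective)
  open import Data.Nat.Combinatorics using (_C_; nCn≡1)
  open import Function using (_∘_)
  open import Relation.Binary.Reasoning.Setoid setoid

  sum-last : ∀ n (g : ℕ → Carrier) →
             sum {suc n} (λ k → g (toℕ k)) ≈ sum {n} (λ k → g (toℕ k)) + g n
  sum-last n g = begin
    sum {suc n} (λ k → g (toℕ k))
      ≈⟨ sum-init-last (λ k → g (toℕ k)) ⟩
    sum {n} (λ k → g (toℕ (inject₁ k))) + g (toℕ (fromℕ n))
      ≡⟨ ≡.cong₂ _+_ (sum-cong-≗ {n} {λ k → g (toℕ (inject₁ k))} (cong g ∘ toℕ-inject₁)) (cong g (toℕ-fromℕ n)) ⟩
    sum {n} (λ k → g (toℕ k)) + g n ∎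

  sum-shift : ∀ n (g : ℕ → Carrier) →
               sum {n} (λ k → g (suc (toℕ k))) + g 0 ≈ sum {n} (λ k → g (toℕ k)) + g n
  sum-shift n g = trans (+-comm _ _) (sum-last n g)

  sum-single : ∀ {n} (f : Fin n → Carrier) i → (∀ j → j ≢ i → f j ≈ 0#) → sum f ≈ f i
  sum-single {suc n} f 0F     f≈0 = begin
    f 0F + sum {n} (λ j → f (1+ j))   ≈⟨ +-congˡ (sum-cong-≋ {n} (λ j → f≈0 (1+ j) λ ())) ⟩
    f 0F + sum {n} (λ _ → 0#)         ≈⟨ +-congˡ (sum-replicate-zero n) ⟩
    f 0F + 0#                         ≈⟨ +-identityʳ _ ⟩
    f 0F                              ∎
  sum-single {suc n} f (1+ i) f≈0 = begin
    f 0F + sum {n} (λ j → f (1+ j))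
      ≈⟨ +-cong (f≈0 0F λ ()) (sum-single (f ∘ 1+_) i λ j j≢i → f≈0 (1+ j) (j≢i ∘ suc-injective)) ⟩
    0# + f (1+ i)
      ≈⟨ +-identityˡ _ ⟩
    f (1+ i) ∎

  binomial-last : ∀ n x y → (x + y) ^ suc n ≈
    sum {suc n} (λ k → (suc n C toℕ k) × (x ^ toℕ k * y ^ (suc n ∸ toℕ k))) + x ^ suc n
  binomial-last n x y = begin
    (x + y) ^ suc n                                    ≈⟨ theorem (suc n) x y ⟩
    sum {suc (suc n)} (λ k → term (toℕ k))             ≈⟨ sum-last (suc n) term ⟩
    sum {suc n} (λ k → term (toℕ k)) + term (suc n)    ≈⟨ +-congˡ top ⟩
    sum {suc n} (λ k → term (toℕ k)) + x ^ suc n       ∎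
    where
    term : ℕ → Carrier
    term k = (suc n C k) × (x ^ k * y ^ (suc n ∸ k))
    top : term (suc n) ≈ x ^ suc n
    top rewrite nCn≡1 (suc n) | ℕₚ.n∸n≡0 n = trans (+-identityʳ _) (*-identityʳ _)

  private
    ×-zero : ∀ m → m × 1# ≈ 0# → ∀ z → m × z ≈ 0#
    ×-zero m m≈0 z = begin
      m × z           ≈⟨ ×-congʳ m (*-identityˡ z) ⟨
      m × (1# * z)    ≈⟨ ×-assoc-* m 1# z ⟨
      (m × 1#) * z    ≈⟨ *-congʳ m≈0 ⟩
      0# * z          ≈⟨ zeroˡ z ⟩
      0#              ∎

  freshman's-dream : ∀ n → (∀ k → 0 ℕ.< k → k ℕ.< suc n → (suc n C k) × 1# ≈ 0#) →
                     ∀ x y → (x + y) ^ suc n ≈ x ^ suc n + y ^ suc n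
  freshman's-dream n C≈0 x y = begin
    (x + y) ^ suc n                                          ≈⟨ binomial-last n x y ⟩
    (term 0 + sum {n} (λ k → term (suc (toℕ k)))) + x ^ suc n    ≈⟨ +-congʳ (+-cong first middle) ⟩
    (y ^ suc n + 0#) + x ^ suc n                              ≈⟨ +-congʳ (+-identityʳ _) ⟩
    y ^ suc n + x ^ suc n                                     ≈⟨ +-comm _ _ ⟩
    x ^ suc n + y ^ suc n                                     ∎
    where
    term : ℕ → Carrier
    term k = (suc n C k) × (x ^ k * y ^ (suc n ∸ k))
    first : term 0 ≈ y ^ suc n
    first = trans (+-identityʳ _) (*-identityˡ _)
    middle : sum {n} (λ k → term (suc (toℕ k))) ≈ 0#
    middle = trans (sum-cong-≋ {n} λ k → ×-zero (suc n C suc (toℕ k)) (C≈0 _ ℕ.z<s (ℕ.s≤s (toℕ<n k))) _)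
                   (sum-replicate-zero n)

module _ where

  open ≡ using (refl; sym; trans; cong₂; module ≡-Reasoning)
  open import Data.Nat.Combinatorics using (_C_; nC1≡n; nCk+nC[k+1]≡[n+1]C[k+1])
  open import Data.Nat.Divisibility using (_∣_; divides; ∣⇒≤)
  open import Data.Nat.Tactic.RingSolver using (solve-∀)
  open import Data.Sum using (inj₁; inj₂)
  open import Data.Nat using (_*_; _+_; _<_)
  open ≡-Reasoning

  [k+1]*[n+1]C[k+1]≡[n+1]*nCk : ∀ n k → suc k * (suc n C suc k) ≡ suc n * (n C k)
  [k+1]*[n+1]C[k+1]≡[n+1]*nCk zero    zero    = refl
  [k+1]*[n+1]C[k+1]≡[n+1]*nCk zero    (suc k) = ℕₚ.*-zeroʳ (suc (suc k))
  [k+1]*[n+1]C[k+1]≡[n+1]*nCk (suc n) zero    =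
    trans (ℕₚ.+-identityʳ _) (trans (nC1≡n (suc (suc n))) (sym (ℕₚ.*-identityʳ _)))
  [k+1]*[n+1]C[k+1]≡[n+1]*nCk (suc n) (suc k) = begin
    suc (suc k) * (suc (suc n) C suc (suc k))
      ≡⟨ cong (suc (suc k) *_) (nCk+nC[k+1]≡[n+1]C[k+1] (suc n) (suc k)) ⟨
    suc (suc k) * (A + D)
      ≡⟨ split k A D ⟩
    A + suc k * A + suc (suc k) * D
      ≡⟨ cong₂ (λ u v → A + u + v) ([k+1]*[n+1]C[k+1]≡[n+1]*nCk n k)
                                   ([k+1]*[n+1]C[k+1]≡[n+1]*nCk n (suc k)) ⟩
    A + suc n * B + suc n * B′
      ≡⟨ merge n A B B′ ⟩
    A + suc n * (B + B′)
      ≡⟨ cong (λ u → A + suc n * u) (nCk+nC[k+1]≡[n+1]C[k+1] n k) ⟩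
    suc (suc n) * A ∎
    where
    A D B B′ : ℕ
    A  = suc n C suc k
    D  = suc n C suc (suc k)
    B  = n C k
    B′ = n C suc k
    split : ∀ k a d → suc (suc k) * (a + d) ≡ a + suc k * a + suc (suc k) * d
    split = solve-∀
    merge : ∀ n a b b′ → a + suc n * b + suc n * b′ ≡ a + suc n * (b + b′)
    merge = solve-∀

  p∣pCk : ∀ {p k} → Prime p → 0 < k → k < p → p ∣ p C k
  p∣pCk {suc n} {suc k} p-prime _ k<p
    with euclidsLemma (suc k) (suc n C suc k) p-prime
           (divides (n C k) (trans ([k+1]*[n+1]C[k+1]≡[n+1]*nCk n k) (ℕₚ.*-comm (suc n) (n C k))))
  ... | inj₁ p∣k = contradiction (∣⇒≤ p∣k) (ℕₚ.<⇒≱ k<p)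
  ... | inj₂ p∣C = p∣C

module Residues (p : ℕ) .{{_ : ℕ.NonZero p}} where

  open import Defs using (𝔽; addF; mulF; zeroF; oneF)
  open import Algebra.Structures {A = 𝔽 p} _≡_ using (IsCommutativeRing)
  open import Data.Fin using (Fin; toℕ)
  open import Data.Fin.Properties using (toℕ-fromℕ<; toℕ-injective; toℕ<n)
  open import Data.Nat.DivMod using (_mod_; _%_; m%n<n; m<n⇒m%n≡m; n%n≡0; %-distribˡ-+; %-distribˡ-*)
  open ≡ using (sym; trans; cong₂; isEquivalence; module ≡-Reasoning)
  open ≡-Reasoning

  private
    F : Set
    F = 𝔽 p

    infixl 6 _+_
    infixl 7 _*_
    infix  8 -_

    _+_ _*_ : F → F → F
    _+_ = addF p
    _*_ = mulF p

    0# 1# : F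
    0# = zeroF p
    1# = oneF p

    -_ : F → F
    - x = (p ℕ.∸ toℕ x) mod p

  toℕ-mod : ∀ n → toℕ (n mod p) ≡ n % p
  toℕ-mod n = toℕ-fromℕ< (m%n<n n p)

  mod-toℕ : ∀ x → toℕ x mod p ≡ x
  mod-toℕ x = toℕ-injective (trans (toℕ-mod (toℕ x)) (m<n⇒m%n≡m (toℕ<n x)))

  private
    %⇒mod : ∀ {m n} → m % p ≡ n % p → m mod p ≡ n mod p
    %⇒mod eq = toℕ-injective (trans (toℕ-mod _) (trans eq (sym (toℕ-mod _))))

  mod-+ : ∀ m n → (m ℕ.+ n) mod p ≡ m mod p + n mod p
  mod-+ m n = %⇒mod (trans (%-distribˡ-+ m n p)
                           (sym (cong₂ (λ u v → (u ℕ.+ v) % p) (toℕ-mod m) (toℕ-mod n))))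

  mod-* : ∀ m n → (m ℕ.* n) mod p ≡ (m mod p) * (n mod p)
  mod-* m n = %⇒mod (trans (%-distribˡ-* m n p)
                           (sym (cong₂ (λ u v → (u ℕ.* v) % p) (toℕ-mod m) (toℕ-mod n))))

  p-mod : p mod p ≡ 0#
  p-mod = %⇒mod (trans (n%n≡0 p) (sym (m<n⇒m%n≡m (ℕ.>-nonZero⁻¹ p))))

  private
    mod-+ˡ : ∀ m z → m mod p + z ≡ (m ℕ.+ toℕ z) mod p
    mod-+ˡ m z = trans (cong ((m mod p) +_) (sym (mod-toℕ z))) (sym (mod-+ m (toℕ z)))

    mod-+ʳ : ∀ z m → z + m mod p ≡ (toℕ z ℕ.+ m) mod p
    mod-+ʳ z m = trans (cong (_+ (m mod p)) (sym (mod-toℕ z))) (sym (mod-+ (toℕ z) m))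

    mod-*ˡ : ∀ m z → (m mod p) * z ≡ (m ℕ.* toℕ z) mod p
    mod-*ˡ m z = trans (cong ((m mod p) *_) (sym (mod-toℕ z))) (sym (mod-* m (toℕ z)))

    mod-*ʳ : ∀ z m → z * (m mod p) ≡ (toℕ z ℕ.* m) mod p
    mod-*ʳ z m = trans (cong (_* (m mod p)) (sym (mod-toℕ z))) (sym (mod-* (toℕ z) m))

    +-assoc : ∀ x y z → (x + y) + z ≡ x + (y + z)
    +-assoc x y z = begin
      (x + y) + z                          ≡⟨ mod-+ˡ (toℕ x ℕ.+ toℕ y) z ⟩
      (toℕ x ℕ.+ toℕ y ℕ.+ toℕ z) mod p    ≡⟨ cong (_mod p) (ℕₚ.+-assoc (toℕ x) _ _) ⟩
      (toℕ x ℕ.+ (toℕ y ℕ.+ toℕ z)) mod p  ≡⟨ mod-+ʳ x (toℕ y ℕ.+ toℕ z) ⟨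
      x + (y + z)                          ∎

    *-assoc : ∀ x y z → (x * y) * z ≡ x * (y * z)
    *-assoc x y z = begin
      (x * y) * z                          ≡⟨ mod-*ˡ (toℕ x ℕ.* toℕ y) z ⟩
      (toℕ x ℕ.* toℕ y ℕ.* toℕ z) mod p    ≡⟨ cong (_mod p) (ℕₚ.*-assoc (toℕ x) _ _) ⟩
      (toℕ x ℕ.* (toℕ y ℕ.* toℕ z)) mod p  ≡⟨ mod-*ʳ x (toℕ y ℕ.* toℕ z) ⟨
      x * (y * z)                          ∎

    +-identityˡ : ∀ x → 0# + x ≡ x
    +-identityˡ x = trans (mod-+ˡ 0 x) (mod-toℕ x)

    *-identityˡ : ∀ x → 1# * x ≡ x
    *-identityˡ x = trans (mod-*ˡ 1 x) (trans (cong (_mod p) (ℕₚ.*-identityˡ (toℕ x))) (mod-toℕ x))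

    -‿inverseˡ : ∀ x → - x + x ≡ 0#
    -‿inverseˡ x = begin
      - x + x                              ≡⟨ mod-+ˡ (p ℕ.∸ toℕ x) x ⟩
      (p ℕ.∸ toℕ x ℕ.+ toℕ x) mod p        ≡⟨ cong (_mod p) (ℕₚ.m∸n+n≡m (ℕₚ.<⇒≤ (toℕ<n x))) ⟩
      p mod p                              ≡⟨ p-mod ⟩
      0#                                   ∎

    distribʳ : ∀ x y z → (y + z) * x ≡ y * x + z * x
    distribʳ x y z = begin
      (y + z) * x
        ≡⟨ mod-*ˡ (toℕ y ℕ.+ toℕ z) x ⟩
      ((toℕ y ℕ.+ toℕ z) ℕ.* toℕ x) mod p
        ≡⟨ cong (_mod p) (ℕₚ.*-distribʳ-+ (toℕ x) (toℕ y) _) ⟩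
      (toℕ y ℕ.* toℕ x ℕ.+ toℕ z ℕ.* toℕ x) mod p
        ≡⟨ mod-+ _ _ ⟩
      y * x + z * x ∎

    +-comm : ∀ x y → x + y ≡ y + x
    +-comm x y = cong (_mod p) (ℕₚ.+-comm (toℕ x) (toℕ y))

    *-comm : ∀ x y → x * y ≡ y * x
    *-comm x y = cong (_mod p) (ℕₚ.*-comm (toℕ x) (toℕ y))

  commutativeRing : CommutativeRing 0ℓ 0ℓ
  commutativeRing = record { isCommutativeRing = isCommutativeRing }
    where
    isCommutativeRing : IsCommutativeRing _+_ _*_ -_ 0# 1#
    isCommutativeRing = record
        { isRing = record
          { +-isAbelianGroup = record
            { isGroup = record
              { isMonoid = record
                { isSemigroup = record
                  { isMagma = record { isEquivalence = isEquivalence ; ∙-cong = cong₂ _+_ }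
                  ; assoc = +-assoc }
                ; identity = +-identityˡ , λ x → trans (+-comm x 0#) (+-identityˡ x) }
              ; inverse = -‿inverseˡ , λ x → trans (+-comm x (- x)) (-‿inverseˡ x)
              ; ⁻¹-cong = cong -_ }
            ; comm = +-comm }
          ; *-cong = cong₂ _*_
          ; *-assoc = *-assoc
          ; *-identity = *-identityˡ , λ x → trans (*-comm x 1#) (*-identityˡ x)
          ; distrib = (λ x y z → trans (*-comm x (y + z))
                                   (trans (distribʳ x y z) (cong₂ _+_ (*-comm y x) (*-comm z x))))
                    , distribʳ }
        ; *-comm = *-comm }

module ResidueRing (p : ℕ) .{{_ : ℕ.NonZero p}} where

  open import Defs using (powF)
  open import Data.Fin using (Fin)
  open import Data.Fin.Permutation using (Permutation; permutation)
  open import Data.Nat.DivMod using (_mod_)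
  import Data.Integer as ℤ
  open ≡ using (refl; sym; trans; cong₂; module ≡-Reasoning)
  open ≡-Reasoning

  open Residues p public
  open CommutativeRing commutativeRing public hiding (refl; sym; trans; reflexive)
  open IntegerCoefficients commutativeRing public
    using (fromℤ; Polynomial; solve; _:+_; _:*_; :-_; _:-_; _:=_; con)
  open import Algebra.Properties.Ring ring public using (-‿involutive; -0#≈0#; -1*x≈-x; x[y-z]≈xy-xz)
  open import Algebra.Properties.Semiring.Exp semiring public using (_^_; ^-homo-*; ^-assocʳ)
  open import Algebra.Properties.Semiring.Mult semiring public using (_×_)
  open import Algebra.Properties.Semiring.Sum semiring public
    using ( sum; sum-permute; sum-cong-≗; sum-replicate; sum-replicate-zero; ∑-distrib-+; ∑-comm
          ; *-distribˡ-sum; *-distribʳ-sum)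

  powF≡^ : ∀ x n → powF p x n ≡ x ^ n
  powF≡^ x zero    = refl
  powF≡^ x (suc n) = cong (x *_) (powF≡^ x n)

  translation : Permutation p p
  translation = permutation (_+ 1#) (_- 1#)
    (solve 1 (λ y → (y :- con (ℤ.+ 1)) :+ con (ℤ.+ 1) := y) refl)
    (solve 1 (λ x → (x :+ con (ℤ.+ 1)) :- con (ℤ.+ 1) := x) refl)

  sum-translate : ∀ (f : Carrier → Carrier) → sum (λ x → f (x + 1#)) ≡ sum f
  sum-translate f = sym (sum-permute f translation)

  ×≡mod* : ∀ n z → n × z ≡ (n mod p) * z
  ×≡mod* zero    z = sym (zeroˡ z)
  ×≡mod* (suc n) z = begin
    z + n × z                      ≡⟨ cong₂ _+_ (sym (*-identityˡ z)) (×≡mod* n z) ⟩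
    1# * z + (n mod p) * z         ≡⟨ distribʳ z 1# (n mod p) ⟨
    (1# + n mod p) * z             ≡⟨ cong (_* z) (mod-+ 1 n) ⟨
    (suc n mod p) * z              ∎

  ×-distrib-sum : ∀ {k} n (f : Fin k → Carrier) → n × sum f ≡ sum (λ i → n × f i)
  ×-distrib-sum {k} n f = begin
    n × sum f                       ≡⟨ ×≡mod* n (sum f) ⟩
    (n mod p) * sum f               ≡⟨ *-distribˡ-sum (n mod p) f ⟩
    sum (λ i → (n mod p) * f i)     ≡⟨ sum-cong-≗ {k} (λ i → ×≡mod* n (f i)) ⟨
    sum (λ i → n × f i)             ∎

  fromℤ-mod : ∀ n → fromℤ (ℤ.+ n) ≡ n mod p
  fromℤ-mod n = begin
    fromℤ (ℤ.+ n)     ≡⟨ ×ᵤ≈× n 1# ⟨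
    n × 1#            ≡⟨ ×≡mod* n 1# ⟩
    (n mod p) * 1#    ≡⟨ *-identityʳ (n mod p) ⟩
    n mod p           ∎
    where open import Algebra.Properties.Semiring.Mult.TCOptimised semiring using (×ᵤ≈×)

  ×-zeroʳ : ∀ n → n × 0# ≡ 0#
  ×-zeroʳ n = trans (×≡mod* n 0#) (zeroʳ (n mod p))

  1^n≡1 : ∀ n → 1# ^ n ≡ 1#
  1^n≡1 zero    = refl
  1^n≡1 (suc n) = trans (*-identityˡ _) (1^n≡1 n)

  inverse-unique : ∀ {x x′ y} → x * y ≡ 1# → x′ * y ≡ 1# → x ≡ x′
  inverse-unique {x} {x′} {y} xy≡1 x′y≡1 = begin
    x                  ≡⟨ *-identityʳ x ⟨
    x * 1#             ≡⟨ cong (x *_) x′y≡1 ⟨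
    x * (x′ * y)       ≡⟨ solve 3 (λ x x′ y → x :* (x′ :* y) := (x :* y) :* x′) refl x x′ y ⟩
    (x * y) * x′       ≡⟨ cong (_* x′) xy≡1 ⟩
    1# * x′            ≡⟨ *-identityˡ x′ ⟩
    x′                 ∎

module PrimeField (p : ℕ) .{{_ : ℕ.NonZero p}} (p-prime : Prime p) where

  open import Data.Fin using (Fin; toℕ)
  open import Data.Fin.Properties using (toℕ-injective; toℕ<n)
  open import Data.Nat using (_<_; s≤s; z≤n)
  import Data.Integer as ℤ
  open import Data.Nat.Combinatorics using (_C_; nC1≡n; nCk≡nC[n∸k])
  open import Data.Nat.DivMod using (_mod_; m<n⇒m%n≡m)
  open import Data.Nat.Divisibility using (_∣_; ∣⇒≤; n∣m⇒m%n≡0; m%n≡0⇒n∣m)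
  open import Data.Nat.Induction using (<-rec)
  open import Data.Nat.Primality using (prime⇒nonTrivial)
  open import Data.Sum using (_⊎_; inj₁; inj₂; [_,_]′)
  open import Function using (flip; id)
  open ≡ using (refl; sym; trans; cong₂; subst; module ≡-Reasoning)
  open ≡-Reasoning

  open ResidueRing p public
  open import Algebra.Properties.Group +-group using (x∙y⁻¹≈ε⇒x≈y; identityˡ-unique)

  N : ℕ
  N = p ∸ 1

  p≡1+N : p ≡ suc N
  p≡1+N = sym (ℕₚ.suc-pred p)

  1<p : 1 < p
  1<p = ℕ.nonTrivial⇒n>1 p {{prime⇒nonTrivial p-prime}}

  0<N : 0 < N
  0<N = ℕₚ.m<n⇒0<n∸m 1<p

  toℕ-0# : toℕ 0# ≡ 0
  toℕ-0# = trans (toℕ-mod 0) (m<n⇒m%n≡m (ℕ.>-nonZero⁻¹ p))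

  mod≡0⇒∣ : ∀ n → n mod p ≡ 0# → p ∣ n
  mod≡0⇒∣ n eq = m%n≡0⇒n∣m n p (trans (sym (toℕ-mod n)) (trans (cong toℕ eq) toℕ-0#))

  ∣⇒mod≡0 : ∀ n → p ∣ n → n mod p ≡ 0#
  ∣⇒mod≡0 n p∣n = toℕ-injective (trans (toℕ-mod n) (trans (n∣m⇒m%n≡0 n p p∣n) (sym toℕ-0#)))

  mod≢0 : ∀ {n} → 0 < n → n < p → n mod p ≢ 0#
  mod≢0 {suc n} _ n<p eq = ℕₚ.<⇒≱ n<p (∣⇒≤ (mod≡0⇒∣ (suc n) eq))

  1≢0 : 1# ≢ 0#
  1≢0 = mod≢0 (s≤s z≤n) 1<p

  -1≢0 : - 1# ≢ 0#
  -1≢0 -1≡0 = 1≢0 (trans (sym (-‿involutive 1#)) (trans (cong -_ -1≡0) -0#≈0#))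

  integral : ∀ x y → x * y ≡ 0# → x ≡ 0# ⊎ y ≡ 0#
  integral x y eq with euclidsLemma (toℕ x) (toℕ y) p-prime (mod≡0⇒∣ _ eq)
  ... | inj₁ p∣x = inj₁ (trans (sym (mod-toℕ x)) (∣⇒mod≡0 (toℕ x) p∣x))
  ... | inj₂ p∣y = inj₂ (trans (sym (mod-toℕ y)) (∣⇒mod≡0 (toℕ y) p∣y))

  *-cancelˡ-≢0 : ∀ x {y z} → x ≢ 0# → x * y ≡ x * z → y ≡ z
  *-cancelˡ-≢0 x {y} {z} x≢0 eq =
    [ flip contradiction x≢0 , x∙y⁻¹≈ε⇒x≈y y z ]′ (integral x (y - z) x[y-z]≡0)
    where
    x[y-z]≡0 : x * (y - z) ≡ 0#
    x[y-z]≡0 = begin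
      x * (y - z)          ≡⟨ x[y-z]≈xy-xz x y z ⟩
      x * y - x * z        ≡⟨ cong (_- x * z) eq ⟩
      x * z - x * z        ≡⟨ -‿inverseʳ (x * z) ⟩
      0#                   ∎

  ^-≢0 : ∀ x n → x ≢ 0# → x ^ n ≢ 0#
  ^-≢0 x zero    x≢0 = 1≢0
  ^-≢0 x (suc n) x≢0 eq with integral x (x ^ n) eq
  ... | inj₁ x≡0  = x≢0 x≡0
  ... | inj₂ xⁿ≡0 = ^-≢0 x n x≢0 xⁿ≡0

  frobenius : ∀ x y → (x + y) ^ p ≡ x ^ p + y ^ p
  frobenius x y = subst (λ q → (x + y) ^ q ≡ x ^ q + y ^ q) (sym p≡1+N)
    (freshman's-dream commutativeSemiring N (subst P p≡1+N p-divides) x y)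
    where
    P : ℕ → Set
    P q = ∀ k → 0 < k → k < q → (q C k) × 1# ≡ 0#
    p-divides : P p
    p-divides k 0<k k<p = begin
      (p C k) × 1#           ≡⟨ ×≡mod* (p C k) 1# ⟩
      ((p C k) mod p) * 1#   ≡⟨ *-identityʳ _ ⟩
      (p C k) mod p          ≡⟨ ∣⇒mod≡0 (p C k) (p∣pCk p-prime 0<k k<p) ⟩
      0#                     ∎

  fermat : ∀ x → x ^ p ≡ x
  fermat x = begin
    x ^ p                  ≡⟨ cong (_^ p) (mod-toℕ x) ⟨
    (toℕ x mod p) ^ p      ≡⟨ fermat-mod (toℕ x) ⟩
    toℕ x mod p            ≡⟨ mod-toℕ x ⟩
    x                      ∎
    where
    fermat-mod : ∀ n → (n mod p) ^ p ≡ n mod p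
    fermat-mod zero    = begin
      0# ^ p                ≡⟨ cong (0# ^_) p≡1+N ⟩
      0# * 0# ^ N           ≡⟨ zeroˡ _ ⟩
      0#                    ∎
    fermat-mod (suc n) = begin
      (suc n mod p) ^ p          ≡⟨ cong (_^ p) (mod-+ 1 n) ⟩
      (1# + n mod p) ^ p         ≡⟨ frobenius 1# (n mod p) ⟩
      1# ^ p + (n mod p) ^ p     ≡⟨ cong₂ _+_ (1^n≡1 p) (fermat-mod n) ⟩
      1# + n mod p               ≡⟨ mod-+ 1 n ⟨
      suc n mod p                ∎

  fermat-unit : ∀ x → x ≢ 0# → x ^ N ≡ 1#
  fermat-unit x x≢0 = *-cancelˡ-≢0 x x≢0 (begin
    x * x ^ N              ≡⟨ cong (x ^_) p≡1+N ⟨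
    x ^ p                  ≡⟨ fermat x ⟩
    x                      ≡⟨ *-identityʳ x ⟨
    x * 1#                 ∎)

  0^n≡0 : ∀ n → 0 < n → 0# ^ n ≡ 0#
  0^n≡0 (suc n) _ = zeroˡ (0# ^ n)

  powerSum : ℕ → Carrier
  powerSum j = sum (λ x → x ^ j)

  -- x ↦ x + 1 permutes 𝔽ₚ, so Σₓ ((x + 1)^(j+1) - x^(j+1)) = 0; expand binomially.
  powerSum-binomial : ∀ j → sum {suc j} (λ k → (suc j C toℕ k) × powerSum (toℕ k)) ≡ 0#
  powerSum-binomial j = begin
    sum {suc j} (λ k → (suc j C toℕ k) × powerSum (toℕ k))
      ≡⟨ sum-cong-≗ {suc j} (λ k → ×-distrib-sum (suc j C toℕ k) (_^ toℕ k)) ⟩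
    sum {suc j} (λ k → sum (λ x → term x k))
      ≡⟨ ∑-comm (λ x k → term x k) ⟨
    sum (λ x → sum {suc j} (λ k → term x k))
      ≡⟨ identityˡ-unique _ _ shifted ⟩
    0# ∎
    where
    term : Carrier → Fin (suc j) → Carrier
    term x k = (suc j C toℕ k) × x ^ toℕ k
    expand : ∀ x → (x + 1#) ^ suc j ≡ sum {suc j} (λ k → term x k) + x ^ suc j
    expand x = trans (binomial-last commutativeSemiring j x 1#)
      (cong (_+ x ^ suc j) (sum-cong-≗ {suc j} (λ k → cong ((suc j C toℕ k) ×_)
        (trans (cong (x ^ toℕ k *_) (1^n≡1 (suc j ∸ toℕ k))) (*-identityʳ (x ^ toℕ k))))))
    shifted : sum (λ x → sum {suc j} (λ k → term x k)) + powerSum (suc j) ≡ powerSum (suc j)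
    shifted = begin
      sum (λ x → sum {suc j} (λ k → term x k)) + powerSum (suc j)
        ≡⟨ ∑-distrib-+ (λ x → sum {suc j} (λ k → term x k)) (_^ suc j) ⟨
      sum (λ x → sum {suc j} (λ k → term x k) + x ^ suc j)
        ≡⟨ sum-cong-≗ {p} expand ⟨
      sum (λ x → (x + 1#) ^ suc j)
        ≡⟨ sum-translate (_^ suc j) ⟩
      powerSum (suc j) ∎

  powerSum<N≡0 : ∀ j → j < N → powerSum j ≡ 0#
  powerSum<N≡0 = <-rec (λ j → j < N → powerSum j ≡ 0#) step
    where
    step : ∀ j → (∀ {i} → i < j → i < N → powerSum i ≡ 0#) → j < N → powerSum j ≡ 0#
    step j ih j<N = [ flip contradiction (mod≢0 (s≤s z≤n) 1+j<p) , id ]′ (integral _ _ leading)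
      where
      1+j<p : suc j < p
      1+j<p = subst (suc j <_) (sym p≡1+N) (s≤s j<N)
      term : ℕ → Carrier
      term k = (suc j C k) × powerSum k
      lower : sum {j} (λ k → term (toℕ k)) ≡ 0#
      lower = trans (sum-cong-≗ {j} λ k → trans (cong ((suc j C toℕ k) ×_) (ih (toℕ<n k) (ℕₚ.<-trans (toℕ<n k) j<N)))
                                                (×-zeroʳ (suc j C toℕ k)))
                    (sum-replicate-zero j)
      top : suc j C j ≡ suc j
      top = trans (nCk≡nC[n∸k] (ℕₚ.n≤1+n j)) (trans (cong (suc j C_) (ℕₚ.m+n∸n≡m 1 j)) (nC1≡n (suc j)))
      leading : (suc j mod p) * powerSum j ≡ 0#
      leading = begin
        (suc j mod p) * powerSum j                 ≡⟨ ×≡mod* (suc j) (powerSum j) ⟨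
        suc j × powerSum j                         ≡⟨ cong (_× powerSum j) top ⟨
        term j                                     ≡⟨ +-identityˡ (term j) ⟨
        0# + term j                                ≡⟨ cong (_+ term j) lower ⟨
        sum {j} (λ k → term (toℕ k)) + term j      ≡⟨ sum-last commutativeSemiring j term ⟨
        sum {suc j} (λ k → term (toℕ k))           ≡⟨ powerSum-binomial j ⟩
        0#                                         ∎

  powerSumN≡-1 : powerSum N ≡ - 1#
  powerSumN≡-1 = begin
    sum (λ x → x ^ N)
      ≡⟨ sum-cong-≗ {p} (λ x → solve 1 (λ y → y := con (ℤ.+ 1) :+ (y :- con (ℤ.+ 1))) refl (x ^ N)) ⟩
    sum (λ x → 1# + (x ^ N - 1#))
      ≡⟨ ∑-distrib-+ (λ _ → 1#) (λ x → x ^ N - 1#) ⟩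
    sum {p} (λ _ → 1#) + sum (λ x → x ^ N - 1#)
      ≡⟨ cong₂ _+_ (sum-replicate p) (sum-single commutativeSemiring (λ x → x ^ N - 1#) 0# off-zero) ⟩
    p × 1# + (0# ^ N - 1#)
      ≡⟨ cong₂ (λ u v → u + (v - 1#)) (trans (×≡mod* p 1#) (trans (*-identityʳ _) p-mod)) (0^n≡0 N 0<N) ⟩
    0# + (0# - 1#)
      ≡⟨ solve 0 (con (ℤ.+ 0) :+ (con (ℤ.+ 0) :- con (ℤ.+ 1)) := :- con (ℤ.+ 1)) refl ⟩
    - 1# ∎
    where
    off-zero : ∀ x → x ≢ 0# → x ^ N - 1# ≡ 0#
    off-zero x x≢0 = trans (cong (_- 1#) (fermat-unit x x≢0)) (-‿inverseʳ 1#)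

module Recurrence (p : ℕ) .{{_ : ℕ.NonZero p}} where

  open import Defs using (IsPadovanRoot)
  open import Data.Product using (_×_; _,_; proj₁)
  import Data.Integer as ℤ
  open ≡ using (refl; trans; cong₂; module ≡-Reasoning)
  open ≡-Reasoning

  open ResidueRing p hiding (_×_)

  PadovanRecurrence : (ℕ → Carrier) → Set
  PadovanRecurrence α = ∀ n → α (n ℕ.+ 3) ≡ α n + α (n ℕ.+ 1)

  powers-padovan : ∀ {r} → IsPadovanRoot p r → PadovanRecurrence (r ^_)
  powers-padovan {r} r³≡r+1 n = begin
    r ^ (n ℕ.+ 3)
      ≡⟨ ^-homo-* r n 3 ⟩
    r ^ n * r ^ 3
      ≡⟨ cong (r ^ n *_) r³≡r+1 ⟩
    r ^ n * (r + 1#)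
      ≡⟨ solve 2 (λ x r → x :* (r :+ con (ℤ.+ 1)) := x :+ x :* (r :* con (ℤ.+ 1))) refl (r ^ n) r ⟩
    r ^ n + r ^ n * r ^ 1
      ≡⟨ cong (r ^ n +_) (^-homo-* r n 1) ⟨
    r ^ n + r ^ (n ℕ.+ 1) ∎

  padovan-unique : ∀ {α β} → PadovanRecurrence α → PadovanRecurrence β →
                   α 0 ≡ β 0 → α 1 ≡ β 1 → α 2 ≡ β 2 → ∀ n → α n ≡ β n
  padovan-unique {α} {β} rα rβ e₀ e₁ e₂ n = proj₁ (window n)
    where
    window : ∀ n → α n ≡ β n × α (suc n) ≡ β (suc n) × α (suc (suc n)) ≡ β (suc (suc n))
    window zero    = e₀ , e₁ , e₂
    window (suc n) with window n
    ... | eₙ , eₙ₊₁ , eₙ₊₂ = eₙ₊₁ , eₙ₊₂ , (begin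
      α (3 ℕ.+ n)
        ≡⟨ cong α (ℕₚ.+-comm 3 n) ⟩
      α (n ℕ.+ 3)
        ≡⟨ rα n ⟩
      α n + α (n ℕ.+ 1)
        ≡⟨ cong₂ _+_ eₙ (trans (cong α (ℕₚ.+-comm n 1)) (trans eₙ₊₁ (cong β (ℕₚ.+-comm 1 n)))) ⟩
      β n + β (n ℕ.+ 1)
        ≡⟨ rβ n ⟨
      β (n ℕ.+ 3)
        ≡⟨ cong β (ℕₚ.+-comm n 3) ⟩
      β (3 ℕ.+ n) ∎)

module Padovan (p : ℕ) .{{_ : ℕ.NonZero p}} (p-prime : Prime p) where

  open import Defs using (IsPadovanRoot; FewerThan3Roots)
  open import Data.Fin using (Fin; toℕ)
  open import Data.Fin.Properties using (toℕ<n; ¬∀⟶∃¬; _≟_)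
  open import Data.Nat using (_<_; _≤_; s≤s; z≤n)
  open import Data.Nat.Divisibility using (_∣_; ∣⇒≤)
  open import Data.Nat.DivMod using (_mod_)
  open import Data.Nat.Primality using (prime⇒irreducible; prime?)
  open import Data.Product using (Σ; _×_; _,_)
  open import Data.Sum using ([_,_]′)
  open import Data.Empty using (⊥-elim)
  open import Function using (flip; id; _∘_)
  open import Relation.Nullary.Decidable using (from-yes; decidable-stable)
  import Data.Integer as ℤ
  open ≡ using (refl; sym; trans; cong₂; module ≡-Reasoning)
  open ≡-Reasoning

  open PrimeField p p-prime hiding (_×_)
  open Recurrence p
  open import Algebra.Properties.Group +-group using (x∙y⁻¹≈ε⇒x≈y; x≈y⇒x∙y⁻¹≈ε; ∙-cancelʳ)

  private
    cubic : Carrier → Carrier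
    cubic x = x ^ 3 - (x + 1#)

    cubicₚ : ∀ {n} → Polynomial n → Polynomial n
    cubicₚ x = x :* (x :* (x :* con (ℤ.+ 1))) :- (x :+ con (ℤ.+ 1))

    root⇒cubic≡0 : ∀ {x} → IsPadovanRoot p x → cubic x ≡ 0#
    root⇒cubic≡0 = x≈y⇒x∙y⁻¹≈ε

    ι : ℕ → Carrier
    ι n = fromℤ (ℤ.+ n)

    vanish₂ : ∀ a b {x y} → x ≡ 0# → y ≡ 0# → a * x + b * y ≡ 0#
    vanish₂ a b refl refl =
      solve 2 (λ a b → a :* con (ℤ.+ 0) :+ b :* con (ℤ.+ 0) := con (ℤ.+ 0)) refl a b

    vanish₃ : ∀ a b c {x y z} → x ≡ 0# → y ≡ 0# → z ≡ 0# → a * x + b * y + c * z ≡ 0#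
    vanish₃ a b c refl refl refl =
      solve 3 (λ a b c → a :* con (ℤ.+ 0) :+ b :* con (ℤ.+ 0) :+ c :* con (ℤ.+ 0) := con (ℤ.+ 0)) refl a b c

    E : Carrier → Carrier → Carrier
    E r s = r * r + r * s + s * s - 1#

    Eₚ : ∀ {n} → Polynomial n → Polynomial n → Polynomial n
    Eₚ r s = r :* r :+ r :* s :+ s :* s :- con (ℤ.+ 1)

    cubic-difference : ∀ r s → (r - s) * E r s ≡ 1# * cubic r + (- 1#) * cubic s
    cubic-difference = solve 2 (λ r s →
      (r :- s) :* Eₚ r s := con (ℤ.+ 1) :* cubicₚ r :+ (:- con (ℤ.+ 1)) :* cubicₚ s) refl

    -- With t = -(r + s), X³ - X - 1 = (X - r)(X - s)(X - t) + E r s · X + (rst - 1).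
    cubic-third : ∀ r s → cubic (- (r + s)) ≡ 1# * cubic r + (- (r + s) - r) * E r s
    cubic-third = solve 2 (λ r s →
      cubicₚ (:- (r :+ s)) := con (ℤ.+ 1) :* cubicₚ r :+ ((:- (r :+ s)) :- r) :* Eₚ r s) refl

    L : Carrier → Carrier
    L r = ι 6 * r + ι 9

    Lₚ : ∀ {n} → Polynomial n → Polynomial n
    Lₚ r = con (ℤ.+ 6) :* r :+ con (ℤ.+ 9)

    Q : Carrier → Carrier → Carrier
    Q r s = s * s - ι 2 * r * s + ι 4 * r * r - 1#

    Qₚ : ∀ {n} → Polynomial n → Polynomial n → Polynomial n
    Qₚ r s = s :* s :- con (ℤ.+ 2) :* r :* s :+ con (ℤ.+ 4) :* r :* r :- con (ℤ.+ 1)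

    -- If s = -2r is a root alongside r, then 6r + 9 = 0, and then 216 (r³ - r - 1) = -621.
    L-elimination : ∀ r s →
      L r ≡ (- ι 8) * cubic r + (- 1#) * cubic s + (- Q r s) * (- (r + s) - r)
    L-elimination = solve 2 (λ r s →
      Lₚ r := (:- con (ℤ.+ 8)) :* cubicₚ r :+ (:- con (ℤ.+ 1)) :* cubicₚ s
              :+ (:- Qₚ r s) :* ((:- (r :+ s)) :- r)) refl

    621-elimination : ∀ r → ι 621 ≡ (L r * L r - ι 27 * L r + ι 207) * L r + (- ι 216) * cubic r
    621-elimination = solve 1 (λ r →
      con (ℤ.+ 621) := (Lₚ r :* Lₚ r :- con (ℤ.+ 27) :* Lₚ r :+ con (ℤ.+ 207)) :* Lₚ r
                       :+ (:- con (ℤ.+ 216)) :* cubicₚ r) refl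

  third-root : ∀ {r s} → IsPadovanRoot p r → IsPadovanRoot p s → r ≢ s → IsPadovanRoot p (- (r + s))
  third-root {r} {s} root-r root-s r≢s = x∙y⁻¹≈ε⇒x≈y _ _ (begin
    cubic (- (r + s))
      ≡⟨ cubic-third r s ⟩
    1# * cubic r + (- (r + s) - r) * E r s
      ≡⟨ vanish₂ 1# (- (r + s) - r) {cubic r} {E r s} (root⇒cubic≡0 root-r) E≡0 ⟩
    0# ∎)
    where
    E≡0 : E r s ≡ 0#
    E≡0 = [ flip contradiction r≢s ∘ x∙y⁻¹≈ε⇒x≈y r s , id ]′ (integral (r - s) (E r s) (begin
      (r - s) * E r s
        ≡⟨ cubic-difference r s ⟩
      1# * cubic r + (- 1#) * cubic s
        ≡⟨ vanish₂ 1# (- 1#) {cubic r} {cubic s} (root⇒cubic≡0 root-r) (root⇒cubic≡0 root-s) ⟩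
      0# ∎))

  double-root⇒p∣621 : ∀ {r s} → IsPadovanRoot p r → IsPadovanRoot p s → - (r + s) ≡ r → p ∣ 621
  double-root⇒p∣621 {r} {s} root-r root-s t≡r = mod≡0⇒∣ 621 (begin
    621 mod p
      ≡⟨ fromℤ-mod 621 ⟨
    ι 621
      ≡⟨ 621-elimination r ⟩
    (L r * L r - ι 27 * L r + ι 207) * L r + (- ι 216) * cubic r
      ≡⟨ vanish₂ (L r * L r - ι 27 * L r + ι 207) (- ι 216) {L r} {cubic r} L≡0 (root⇒cubic≡0 root-r) ⟩
    0# ∎)
    where
    L≡0 : L r ≡ 0#
    L≡0 = trans (L-elimination r s) (vanish₃ (- ι 8) (- 1#) (- Q r s) {cubic r} {cubic s} { - (r + s) - r}
                  (root⇒cubic≡0 root-r) (root⇒cubic≡0 root-s) (x≈y⇒x∙y⁻¹≈ε { - (r + s)} {r} t≡r))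

  p∣621⇒p≡23 : 5 ≤ p → p ∣ 621 → p ≡ 23
  p∣621⇒p≡23 5≤p p∣621 = [ p∣27⇒⊥ , p∣23⇒≡23 ]′ (euclidsLemma 27 23 p-prime p∣621)
    where
    p∣27⇒⊥ : p ∣ 27 → p ≡ 23
    p∣27⇒⊥ p∣27 = contradiction (∣⇒≤ p∣3) (ℕₚ.<⇒≱ (ℕₚ.<-≤-trans (s≤s (s≤s (s≤s (s≤s z≤n)))) 5≤p))
      where
      p∣3 : p ∣ 3
      p∣3 = [ id , [ id , id ]′ ∘ euclidsLemma 3 3 p-prime ]′ (euclidsLemma 3 9 p-prime p∣27)
    p∣23⇒≡23 : p ∣ 23 → p ≡ 23
    p∣23⇒≡23 p∣23 = [ (λ p≡1 → contradiction 1<p (ℕₚ.<-irrefl (sym p≡1))) , id ]′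
                         (prime⇒irreducible {23} (from-yes (prime? 23)) p∣23)

  unique-root : 5 ≤ p → p ≢ 23 → FewerThan3Roots p →
                ∀ {r s} → IsPadovanRoot p r → IsPadovanRoot p s → r ≡ s
  unique-root 5≤p p≢23 fewer {r} {s} root-r root-s with r ≟ s
  ... | yes r≡s = r≡s
  ... | no  r≢s =
    ⊥-elim (fewer (r , s , - (r + s) , root-r , root-s , third-root root-r root-s r≢s , r≢s , r≢t , s≢t))
    where
    r≢t : r ≢ - (r + s)
    r≢t r≡t = p≢23 (p∣621⇒p≡23 5≤p (double-root⇒p∣621 root-r root-s (sym r≡t)))
    s≢t : s ≢ - (r + s)
    s≢t s≡t =
      p≢23 (p∣621⇒p≡23 5≤p (double-root⇒p∣621 root-s root-r (trans (cong -_ (+-comm s r)) (sym s≡t))))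

  Periodic : (ℕ → Carrier) → Set
  Periodic α = ∀ n → α (n ℕ.+ N) ≡ α n

  module Resolvent (α : ℕ → Carrier) (α-periodic : Periodic α) where

    -- c^(N-k) stands for c^(-k) without needing an inverse.
    resolvent : Carrier → ℕ → Carrier
    resolvent c n = sum {N} (λ k → c ^ (N ∸ toℕ k) * α (n ℕ.+ toℕ k))

    resolvent-suc : ∀ c n → resolvent c (suc n) ≡ c * resolvent c n
    resolvent-suc c n = ∙-cancelʳ (f N) (resolvent c (suc n)) (c * resolvent c n) (begin
      resolvent c (suc n) + f N
        ≡⟨ cong₂ _+_ (sum-cong-≗ {N} λ k → cong (λ i → c ^ (N ∸ toℕ k) * α i) (ℕₚ.+-suc n (toℕ k))) f₀≡fN ⟨
      sum {N} (λ k → f (suc (toℕ k))) + f 0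
        ≡⟨ sum-shift commutativeSemiring N f ⟩
      sum {N} (λ k → f (toℕ k)) + f N
        ≡⟨ cong (_+ f N) shifted ⟩
      c * resolvent c n + f N ∎)
      where
      f : ℕ → Carrier
      f k = c ^ (suc N ∸ k) * α (n ℕ.+ k)
      f₀≡fN : f 0 ≡ f N
      f₀≡fN = begin
        c ^ suc N * α (n ℕ.+ 0)
          ≡⟨ cong₂ _*_ (trans (cong (c ^_) (sym p≡1+N)) (fermat c)) (cong α (ℕₚ.+-identityʳ n)) ⟩
        c * α n
          ≡⟨ cong₂ _*_ (sym (*-identityʳ c)) (sym (α-periodic n)) ⟩
        c ^ 1 * α (n ℕ.+ N)
          ≡⟨ cong (λ i → c ^ i * α (n ℕ.+ N)) (ℕₚ.m+n∸n≡m 1 N) ⟨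
        f N ∎
      shifted : sum {N} (λ k → f (toℕ k)) ≡ c * resolvent c n
      shifted = begin
        sum {N} (λ k → f (toℕ k))
          ≡⟨ sum-cong-≗ {N} (λ k → step (toℕ k) (ℕₚ.<⇒≤ (toℕ<n k))) ⟩
        sum {N} (λ k → c * (c ^ (N ∸ toℕ k) * α (n ℕ.+ toℕ k)))
          ≡⟨ *-distribˡ-sum {N} c (λ k → c ^ (N ∸ toℕ k) * α (n ℕ.+ toℕ k)) ⟨
        c * resolvent c n ∎
        where
        step : ∀ k → k ≤ N → f k ≡ c * (c ^ (N ∸ k) * α (n ℕ.+ k))
        step k k≤N = trans (cong (λ i → c ^ i * α (n ℕ.+ k)) (ℕₚ.+-∸-assoc 1 k≤N))
                           (*-assoc c (c ^ (N ∸ k)) (α (n ℕ.+ k)))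

    resolvent-geometric : ∀ c n → resolvent c n ≡ c ^ n * resolvent c 0
    resolvent-geometric c zero    = sym (*-identityˡ (resolvent c 0))
    resolvent-geometric c (suc n) = begin
      resolvent c (suc n)              ≡⟨ resolvent-suc c n ⟩
      c * resolvent c n                ≡⟨ cong (c *_) (resolvent-geometric c n) ⟩
      c * (c ^ n * resolvent c 0)      ≡⟨ *-assoc c (c ^ n) (resolvent c 0) ⟨
      c ^ suc n * resolvent c 0        ∎

    resolvent-padovan : PadovanRecurrence α → ∀ c → PadovanRecurrence (resolvent c)
    resolvent-padovan α-padovan c n = begin
      resolvent c (n ℕ.+ 3)
        ≡⟨ sum-cong-≗ {N} (λ k → step (toℕ k)) ⟩
      sum {N} (λ k → term n (toℕ k) + term (n ℕ.+ 1) (toℕ k))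
        ≡⟨ ∑-distrib-+ {N} (λ k → term n (toℕ k)) (λ k → term (n ℕ.+ 1) (toℕ k)) ⟩
      resolvent c n + resolvent c (n ℕ.+ 1) ∎
      where
      open import Algebra.Properties.CommutativeSemigroup ℕₚ.+-commutativeSemigroup
        using () renaming (xy∙z≈xz∙y to ℕ-xy∙z≈xz∙y)
      term : ℕ → ℕ → Carrier
      term m k = c ^ (N ∸ k) * α (m ℕ.+ k)
      step : ∀ k → term (n ℕ.+ 3) k ≡ term n k + term (n ℕ.+ 1) k
      step k = begin
        c ^ (N ∸ k) * α (n ℕ.+ 3 ℕ.+ k)
          ≡⟨ cong (λ i → c ^ (N ∸ k) * α i) (ℕ-xy∙z≈xz∙y n 3 k) ⟩
        c ^ (N ∸ k) * α (n ℕ.+ k ℕ.+ 3)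
          ≡⟨ cong (c ^ (N ∸ k) *_) (α-padovan (n ℕ.+ k)) ⟩
        c ^ (N ∸ k) * (α (n ℕ.+ k) + α (n ℕ.+ k ℕ.+ 1))
          ≡⟨ distribˡ (c ^ (N ∸ k)) (α (n ℕ.+ k)) (α (n ℕ.+ k ℕ.+ 1)) ⟩
        term n k + c ^ (N ∸ k) * α (n ℕ.+ k ℕ.+ 1)
          ≡⟨ cong (λ i → term n k + c ^ (N ∸ k) * α i) (ℕ-xy∙z≈xz∙y n k 1) ⟩
        term n k + term (n ℕ.+ 1) k ∎

    resolvent≢0⇒root : PadovanRecurrence α → ∀ c → resolvent c 0 ≢ 0# → IsPadovanRoot p c
    resolvent≢0⇒root α-padovan c R≢0 = *-cancelˡ-≢0 R {c ^ 3} {c + 1#} R≢0 (begin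
      R * c ^ 3
        ≡⟨ *-comm R (c ^ 3) ⟩
      c ^ 3 * R
        ≡⟨ resolvent-geometric c 3 ⟨
      resolvent c 3
        ≡⟨ resolvent-padovan α-padovan c 0 ⟩
      resolvent c 0 + resolvent c 1
        ≡⟨ cong (R +_) (resolvent-geometric c 1) ⟩
      R + c ^ 1 * R
        ≡⟨ solve 2 (λ R c → R :+ (c :* con (ℤ.+ 1)) :* R := R :* (c :+ con (ℤ.+ 1))) refl R c ⟩
      R * (c + 1#) ∎)
      where
      R : Carrier
      R = resolvent c 0

    sum-resolvent : ∀ n → sum (λ c → resolvent c n) ≡ - α n
    sum-resolvent n = begin
      sum (λ c → resolvent c n)
        ≡⟨ ∑-comm {p} {N} (λ c k → c ^ (N ∸ toℕ k) * α (n ℕ.+ toℕ k)) ⟩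
      sum {N} (λ k → sum (λ c → c ^ (N ∸ toℕ k) * α (n ℕ.+ toℕ k)))
        ≡⟨ sum-cong-≗ {N} (λ k → *-distribʳ-sum (α (n ℕ.+ toℕ k)) (_^ (N ∸ toℕ k))) ⟨
      sum {N} (λ k → g (toℕ k))
        ≡⟨ ∙-cancelʳ (g N) _ _ rotated ⟩
      - α n ∎
      where
      g : ℕ → Carrier
      g k = powerSum (N ∸ k) * α (n ℕ.+ k)
      g-suc : ∀ k → k < N → g (suc k) ≡ 0#
      g-suc k k<N = trans (cong (_* α (n ℕ.+ suc k)) (powerSum<N≡0 (N ∸ suc k) (ℕₚ.∸-monoʳ-< (s≤s z≤n) k<N)))
                          (zeroˡ _)
      rotated : sum {N} (λ k → g (toℕ k)) + g N ≡ - α n + g N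
      rotated = begin
        sum {N} (λ k → g (toℕ k)) + g N
          ≡⟨ sum-shift commutativeSemiring N g ⟨
        sum {N} (λ k → g (suc (toℕ k))) + g 0
          ≡⟨ cong₂ _+_ (trans (sum-cong-≗ {N} (λ k → g-suc (toℕ k) (toℕ<n k))) (sum-replicate-zero N)) g₀ ⟩
        0# + - α n
          ≡⟨ +-identityˡ (- α n) ⟩
        - α n
          ≡⟨ +-identityʳ (- α n) ⟨
        - α n + 0#
          ≡⟨ cong (- α n +_) gN≡0 ⟨
        - α n + g N ∎
        where
        g₀ : g 0 ≡ - α n
        g₀ = trans (cong₂ _*_ powerSumN≡-1 (cong α (ℕₚ.+-identityʳ n))) (-1*x≈-x (α n))
        gN≡0 : g N ≡ 0#
        gN≡0 = trans (cong (λ j → powerSum j * α (n ℕ.+ N)) (ℕₚ.n∸n≡0 N))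
                    (trans (cong (_* α (n ℕ.+ N)) (powerSum<N≡0 0 0<N)) (zeroˡ _))

  periodic-padovan⇒powers : 5 ≤ p → p ≢ 23 → FewerThan3Roots p →
    ∀ {α} → Periodic α → PadovanRecurrence α → α 0 ≡ 1# →
    Σ Carrier λ r → IsPadovanRoot p r × (∀ n → α n ≡ r ^ n)
  periodic-padovan⇒powers 5≤p p≢23 fewer {α} α-periodic α-padovan α₀≡1 =
    geometric (¬∀⟶∃¬ p (λ c → resolvent c 0 ≡ 0#) (λ c → resolvent c 0 ≟ 0#) (-1≢0 ∘ -1≡0))
    where
    open Resolvent α α-periodic

    -1≡0 : (∀ c → resolvent c 0 ≡ 0#) → - 1# ≡ 0#
    -1≡0 all-zero = begin
      - 1#                         ≡⟨ cong -_ α₀≡1 ⟨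
      - α 0                        ≡⟨ sum-resolvent 0 ⟨
      sum (λ c → resolvent c 0)    ≡⟨ sum-cong-≗ {p} all-zero ⟩
      sum {p} (λ _ → 0#)           ≡⟨ sum-replicate-zero p ⟩
      0#                           ∎

    geometric : (Σ Carrier λ r → resolvent r 0 ≢ 0#) → Σ Carrier λ r → IsPadovanRoot p r × (∀ n → α n ≡ r ^ n)
    geometric (r , R≢0) = r , root-r , α≡rⁿ
      where
      root-r : IsPadovanRoot p r
      root-r = resolvent≢0⇒root α-padovan r R≢0

      others-vanish : ∀ c → c ≢ r → resolvent c 0 ≡ 0#
      others-vanish c c≢r = decidable-stable (resolvent c 0 ≟ 0#) λ Rc≢0 →
        c≢r (unique-root 5≤p p≢23 fewer (resolvent≢0⇒root α-padovan c Rc≢0) root-r)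

      collapse : ∀ n → - α n ≡ r ^ n * resolvent r 0
      collapse n = begin
        - α n
          ≡⟨ sum-resolvent n ⟨
        sum (λ c → resolvent c n)
          ≡⟨ sum-single commutativeSemiring (λ c → resolvent c n) r off-r ⟩
        resolvent r n
          ≡⟨ resolvent-geometric r n ⟩
        r ^ n * resolvent r 0 ∎
        where
        off-r : ∀ c → c ≢ r → resolvent c n ≡ 0#
        off-r c c≢r =
          trans (resolvent-geometric c n) (trans (cong (c ^ n *_) (others-vanish c c≢r)) (zeroʳ (c ^ n)))

      R₀≡-1 : resolvent r 0 ≡ - 1#
      R₀≡-1 = trans (sym (*-identityˡ (resolvent r 0))) (trans (sym (collapse 0)) (cong -_ α₀≡1))

      α≡rⁿ : ∀ n → α n ≡ r ^ n
      α≡rⁿ n = begin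
        α n
          ≡⟨ -‿involutive (α n) ⟨
        - (- α n)
          ≡⟨ cong -_ (collapse n) ⟩
        - (r ^ n * resolvent r 0)
          ≡⟨ cong (λ R → - (r ^ n * R)) R₀≡-1 ⟩
        - (r ^ n * - 1#)
          ≡⟨ solve 1 (λ x → :- (x :* (:- con (ℤ.+ 1))) := x) refl (r ^ n) ⟩
        r ^ n ∎

module Padovan23 where

  open import Defs using (IsPadovanRoot)
  open import Data.Fin using (Fin; toℕ)
  open import Data.Fin.Properties using (all?; _≟_; toℕ<n)
  open import Data.Nat using (_≤_; _≤?_; s≤s; z≤n)
  open import Data.Product using (_×_; _,_; proj₁; proj₂)
  open import Data.Nat.DivMod using (_mod_)
  open import Relation.Nullary.Decidable using (Dec; from-yes; _×-dec_; _→-dec_)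
  open ≡ using (refl; sym; trans; subst)

  open ResidueRing 23 hiding (_×_)
  open Recurrence 23

  ten : Carrier
  ten = 10 mod 23

  ten-root : IsPadovanRoot 23 ten
  ten-root = refl

  -- A three-term window keeps the search linear; defining step by projections makes the
  -- recurrence hold by computation.
  padovanFrom : Carrier → Carrier → ℕ → Carrier
  padovanFrom x y n = proj₁ (window n)
    where
    step : Carrier × Carrier × Carrier → Carrier × Carrier × Carrier
    step t = proj₁ (proj₂ t) , proj₂ (proj₂ t) , proj₁ t + proj₁ (proj₂ t)
    window : ℕ → Carrier × Carrier × Carrier
    window zero    = 1# , x , y
    window (suc n) = step (window n)

  padovanFrom-recurrence : ∀ x y → PadovanRecurrence (padovanFrom x y)
  padovanFrom-recurrence x y n = trans (cong (padovanFrom x y) (ℕₚ.+-comm n 3))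
                                   (cong (padovanFrom x y n +_) (cong (padovanFrom x y) (ℕₚ.+-comm 1 n)))

  StartsComplete : Carrier → Carrier → Set
  StartsComplete x y = (∀ (k : Fin 21) → 2 ≤ toℕ (padovanFrom x y (suc (toℕ k)))) × padovanFrom x y 22 ≡ 1#

  only-ten : ∀ x y → StartsComplete x y → x ≡ ten × y ≡ ten ^ 2
  only-ten = from-yes checked
    where
    checked : Dec (∀ x y → StartsComplete x y → x ≡ ten × y ≡ ten ^ 2)
    checked = all? λ x → all? λ y →
      ((all? λ k → 2 ≤? toℕ (padovanFrom x y (suc (toℕ k)))) ×-dec (padovanFrom x y 22 ≟ 1#))
      →-dec ((x ≟ ten) ×-dec (y ≟ ten ^ 2))

  complete⇒powers-of-ten : ∀ {α} → PadovanRecurrence α → α 0 ≡ 1# →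
                (∀ i → 1 ≤ i → i ≤ 21 → 2 ≤ toℕ (α i)) → α 22 ≡ 1# → ∀ n → α n ≡ ten ^ n
  complete⇒powers-of-ten {α} α-padovan α₀≡1 bounds α₂₂≡1 =
    padovan-unique α-padovan (powers-padovan ten-root) α₀≡1 (proj₁ start) (proj₂ start)
    where
    α≡padovan : ∀ n → α n ≡ padovanFrom (α 1) (α 2) n
    α≡padovan = padovan-unique α-padovan (padovanFrom-recurrence (α 1) (α 2)) α₀≡1 refl refl
    start : α 1 ≡ ten × α 2 ≡ ten ^ 2
    start = only-ten (α 1) (α 2)
      ( (λ k → subst (λ z → 2 ≤ toℕ z) (α≡padovan (suc (toℕ k)))
                       (bounds (suc (toℕ k)) (s≤s z≤n) (toℕ<n k)))
      , trans (sym (α≡padovan 22)) α₂₂≡1 )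

module Complete (p : ℕ) .{{_ : ℕ.NonZero p}} (p-prime : Prime p) where

  open import Defs using (IsPrimitiveRoot; IsPowerSeq; IsComplete; powF)
  open import Data.Empty using (⊥; ⊥-elim)
  import Data.Fin
  open import Data.Fin using (Fin; toℕ; fromℕ<)
  open import Data.Fin.Properties using (toℕ-injective; toℕ<n; toℕ-fromℕ<; any?; pigeonhole; _≟_)
  open import Data.Integer as ℤ using (ℤ; +_; -[1+_])
  import Data.Integer.Properties as ℤₚ
  open import Data.Nat using (_<_; _≤_; s≤s; z≤n)
  open import Data.Nat.DivMod using (m<n⇒m%n≡m)
  open import Data.Product using (Σ; _×_; _,_; proj₁; proj₂)
  open import Function using (_∘_)
  open ≡ using (sym; trans; subst; module ≡-Reasoning)
  open ≡-Reasoning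

  open PrimeField p p-prime hiding (_×_)

  toℕ-1# : toℕ 1# ≡ 1
  toℕ-1# = trans (toℕ-mod 1) (m<n⇒m%n≡m 1<p)

  2≤⇒≢0 : ∀ {x} → 2 ≤ toℕ x → x ≢ 0#
  2≤⇒≢0 2≤x x≡0 = contradiction (subst (2 ≤_) (trans (cong toℕ x≡0) toℕ-0#) 2≤x) λ ()

  2≤⇒≢1 : ∀ {x} → 2 ≤ toℕ x → x ≢ 1#
  2≤⇒≢1 2≤x x≡1 = contradiction (subst (2 ≤_) (trans (cong toℕ x≡1) toℕ-1#) 2≤x) λ { (s≤s ()) }

  ≢0,1⇒2≤ : ∀ {x} → x ≢ 0# → x ≢ 1# → 2 ≤ toℕ x
  ≢0,1⇒2≤ {x} x≢0 x≢1 with toℕ x in eq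
  ... | 0           = contradiction (toℕ-injective (trans eq (sym toℕ-0#))) x≢0
  ... | 1           = contradiction (toℕ-injective (trans eq (sym toℕ-1#))) x≢1
  ... | suc (suc _) = s≤s (s≤s z≤n)

  ≤p∸2⇒<N : ∀ {i} → i ≤ p ∸ 2 → i < N
  ≤p∸2⇒<N {i} i≤p∸2 = ℕ.s≤s⁻¹ (subst (suc (suc i) ≤_) p≡1+N
    (subst (_≤ p) (ℕₚ.+-comm i 2) (ℕₚ.m≤o∸n⇒m+n≤o i 1<p i≤p∸2)))

  <N⇒≤p∸2 : ∀ {i} → i < N → i ≤ p ∸ 2
  <N⇒≤p∸2 {i} i<N = ℕₚ.m+n≤o⇒m≤o∸n i
    (subst (_≤ p) (ℕₚ.+-comm 2 i) (subst (suc (suc i) ≤_) (sym p≡1+N) (s≤s i<N)))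

  module PrimitiveRoot {b} (b-primitive : IsPrimitiveRoot p b) where

    b≢0 : b ≢ 0#
    b≢0 = proj₁ b-primitive

    bᴺ≡1 : b ^ N ≡ 1#
    bᴺ≡1 = trans (sym (powF≡^ b N)) (proj₁ (proj₂ b-primitive))

    bᵏ≢1 : ∀ {k} → 1 ≤ k → k < N → b ^ k ≢ 1#
    bᵏ≢1 {k} 1≤k k<N = proj₂ (proj₂ b-primitive) k 1≤k k<N ∘ trans (powF≡^ b k)

    powers-injective : ∀ {i j} → i < j → j < N → b ^ i ≢ b ^ j
    powers-injective {i} {j} i<j j<N bⁱ≡bʲ =
      bᵏ≢1 (ℕₚ.m<n⇒0<n∸m i<j) (ℕₚ.≤-<-trans (ℕₚ.m∸n≤m j i) j<N)
           (sym (*-cancelˡ-≢0 (b ^ i) (^-≢0 b i b≢0) (begin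
        b ^ i * 1#                ≡⟨ *-identityʳ (b ^ i) ⟩
        b ^ i                     ≡⟨ bⁱ≡bʲ ⟩
        b ^ j                     ≡⟨ cong (b ^_) (ℕₚ.m+[n∸m]≡n (ℕₚ.<⇒≤ i<j)) ⟨
        b ^ (i ℕ.+ (j ∸ i))       ≡⟨ ^-homo-* b i (j ∸ i) ⟩
        b ^ i * b ^ (j ∸ i)       ∎)))

    -- If y were not a power, 0, y, b⁰, …, b^(N-1) would be p + 1 distinct elements of 𝔽ₚ.
    powers-surjective : ∀ {y} → y ≢ 0# → Σ ℕ λ i → i < N × b ^ i ≡ y
    powers-surjective {y} y≢0 with any? (λ (i : Fin N) → b ^ toℕ i ≟ y)
    ... | yes (i , bⁱ≡y) = toℕ i , toℕ<n i , bⁱ≡y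
    ... | no  not-power  = ⊥-elim (collision (pigeonhole (ℕₚ.n<1+n p) (candidate ∘ toℕ)))
      where
      candidate : ℕ → Carrier
      candidate 0             = 0#
      candidate 1             = y
      candidate (suc (suc i)) = b ^ i
      small : ∀ {n} → suc (suc n) ≤ p → n < N
      small 2+n≤p = ℕ.s≤s⁻¹ (subst (_ ≤_) p≡1+N 2+n≤p)
      distinct : ∀ {m n} → m < n → n ≤ p → candidate m ≢ candidate n
      distinct {0}           {1}           _                  _    e = y≢0 (sym e)
      distinct {0}           {suc (suc n)} _                  _    e = ^-≢0 b n b≢0 (sym e)
      distinct {1}           {1}           (s≤s ())
      distinct {1}           {suc (suc n)} _                  n≤p e =
        not-power (fromℕ< (small n≤p) , trans (cong (b ^_) (toℕ-fromℕ< (small n≤p))) (sym e))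
      distinct {suc (suc m)} {suc (suc n)} (s≤s (s≤s m<n)) n≤p e = powers-injective m<n (small n≤p) e
      collision : (Σ (Fin (suc p)) λ i → Σ (Fin (suc p)) λ j →
                    Data.Fin._<_ i j × candidate (toℕ i) ≡ candidate (toℕ j)) → ⊥
      collision (i , j , i<j , e) = distinct i<j (ℕ.s≤s⁻¹ (toℕ<n j)) e

  module IntegerIndexed {a : ℤ → Carrier} {b} (bᴺ≡1 : b ^ N ≡ 1#) (a₊ : ∀ n → a (+ n) ≡ b ^ n) where

    private instance
      N-nonZero : ℕ.NonZero N
      N-nonZero = ℕ.>-nonZero 0<N

    periodic⇒inverses : (∀ z → a (z ℤ.+ + N) ≡ a z) → ∀ k → a -[1+ k ] * b ^ suc k ≡ 1#
    periodic⇒inverses a-periodic k = begin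
      a -[1+ k ] * b ^ suc k
        ≡⟨ cong (_* b ^ suc k) (iterate (suc k) -[1+ k ]) ⟨
      a (-[1+ k ] ℤ.+ + (suc k ℕ.* N)) * b ^ suc k
        ≡⟨ cong (λ z → a z * b ^ suc k) (ℤₚ.⊖-≥ k+1≤[k+1]N) ⟩
      a (+ M) * b ^ suc k
        ≡⟨ cong (_* b ^ suc k) (a₊ M) ⟩
      b ^ M * b ^ suc k
        ≡⟨ ^-homo-* b M (suc k) ⟨
      b ^ (M ℕ.+ suc k)
        ≡⟨ cong (b ^_) (trans (ℕₚ.m∸n+n≡m k+1≤[k+1]N) (ℕₚ.*-comm (suc k) N)) ⟩
      b ^ (N ℕ.* suc k)
        ≡⟨ ^-assocʳ b N (suc k) ⟨
      (b ^ N) ^ suc k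
        ≡⟨ cong (_^ suc k) bᴺ≡1 ⟩
      1# ^ suc k
        ≡⟨ 1^n≡1 (suc k) ⟩
      1# ∎
      where
      k+1≤[k+1]N : suc k ≤ suc k ℕ.* N
      k+1≤[k+1]N = ℕₚ.m≤m*n (suc k) N
      M : ℕ
      M = suc k ℕ.* N ∸ suc k
      iterate : ∀ m z → a (z ℤ.+ + (m ℕ.* N)) ≡ a z
      iterate zero    z = cong a (ℤₚ.+-identityʳ z)
      iterate (suc m) z = begin
        a (z ℤ.+ (+ N ℤ.+ + (m ℕ.* N)))
          ≡⟨ cong a (trans (cong (λ w → z ℤ.+ w) (ℤₚ.+-comm (+ N) (+ (m ℕ.* N))))
                           (sym (ℤₚ.+-assoc z (+ (m ℕ.* N)) (+ N)))) ⟩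
        a (z ℤ.+ + (m ℕ.* N) ℤ.+ + N)
          ≡⟨ a-periodic _ ⟩
        a (z ℤ.+ + (m ℕ.* N))
          ≡⟨ iterate m z ⟩
        a z ∎

    inverses⇒periodic : (∀ k → a -[1+ k ] * b ^ suc k ≡ 1#) → ∀ z → a (z ℤ.+ + N) ≡ a z
    inverses⇒periodic a₋ (+ n) = begin
      a (+ (n ℕ.+ N))          ≡⟨ a₊ (n ℕ.+ N) ⟩
      b ^ (n ℕ.+ N)            ≡⟨ ^-homo-* b n N ⟩
      b ^ n * b ^ N            ≡⟨ cong (b ^ n *_) bᴺ≡1 ⟩
      b ^ n * 1#               ≡⟨ *-identityʳ (b ^ n) ⟩
      b ^ n                    ≡⟨ a₊ n ⟨
      a (+ n)                  ∎
    inverses⇒periodic a₋ -[1+ k ] with suc k ℕₚ.≤? N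
    ... | yes k<N = inverse-unique (begin
      a (N ⊖ suc k) * b ^ suc k            ≡⟨ cong (λ z → a z * b ^ suc k) (ℤₚ.⊖-≥ k<N) ⟩
      a (+ (N ∸ suc k)) * b ^ suc k        ≡⟨ cong (_* b ^ suc k) (a₊ (N ∸ suc k)) ⟩
      b ^ (N ∸ suc k) * b ^ suc k          ≡⟨ ^-homo-* b (N ∸ suc k) (suc k) ⟨
      b ^ (N ∸ suc k ℕ.+ suc k)            ≡⟨ cong (b ^_) (ℕₚ.m∸n+n≡m k<N) ⟩
      b ^ N                                ≡⟨ bᴺ≡1 ⟩
      1#                                   ∎) (a₋ k)
      where open import Data.Integer using (_⊖_)
    ... | no  k≮N = trans (cong a -[1+k]+N) (inverse-unique (a₋ (k ∸ N)) (begin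
      a -[1+ k ] * b ^ suc (k ∸ N)
        ≡⟨ cong (a -[1+ k ] *_) (*-identityʳ _) ⟨
      a -[1+ k ] * (b ^ suc (k ∸ N) * 1#)
        ≡⟨ cong (λ u → a -[1+ k ] * (b ^ suc (k ∸ N) * u)) bᴺ≡1 ⟨
      a -[1+ k ] * (b ^ suc (k ∸ N) * b ^ N)
        ≡⟨ cong (a -[1+ k ] *_) (^-homo-* b (suc (k ∸ N)) N) ⟨
      a -[1+ k ] * b ^ (suc (k ∸ N) ℕ.+ N)
        ≡⟨ cong (λ i → a -[1+ k ] * b ^ suc i) (ℕₚ.m∸n+n≡m N≤k) ⟩
      a -[1+ k ] * b ^ suc k
        ≡⟨ a₋ k ⟩
      1# ∎))
      where
      N≤k : N ≤ k
      N≤k = ℕ.s≤s⁻¹ (ℕₚ.≰⇒> k≮N)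
      -[1+k]+N : -[1+ k ] ℤ.+ + N ≡ -[1+ k ∸ N ]
      -[1+k]+N = trans (ℤₚ.⊖-< (ℕₚ.≰⇒> k≮N)) (cong (λ i → ℤ.- (+ i)) (ℕₚ.+-∸-assoc 1 N≤k))

  complete⇒primitive : ∀ {a r} → a (+ 0) ≡ 1# → IsComplete p a → (∀ n → a (+ n) ≡ powF p r n) →
                       IsPrimitiveRoot p r × IsPowerSeq p a r
  complete⇒primitive {a} {r} a₀≡1 (a-periodic , a-bounds , _) a≡rⁿ =
    (r≢0 , trans (powF≡^ r N) rᴺ≡1 , rᵏ≢1) ,
    a≡rⁿ ,
    (λ k → trans (cong (a -[1+ k ] *_) (powF≡^ r (suc k))) (periodic⇒inverses a-periodic k))
    where
    a≡rⁿ′ : ∀ n → a (+ n) ≡ r ^ n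
    a≡rⁿ′ n = trans (a≡rⁿ n) (powF≡^ r n)
    rᴺ≡1 : r ^ N ≡ 1#
    rᴺ≡1 = trans (sym (a≡rⁿ′ N)) (trans (a-periodic (+ 0)) a₀≡1)
    r≢0 : r ≢ 0#
    r≢0 r≡0 = 1≢0 (trans (sym rᴺ≡1) (trans (cong (_^ N) r≡0) (0^n≡0 N 0<N)))
    rᵏ≢1 : ∀ k → 1 ≤ k → k < N → powF p r k ≢ 1#
    rᵏ≢1 k 1≤k k<N rᵏ≡1 = 2≤⇒≢1 (a-bounds k 1≤k (<N⇒≤p∸2 k<N)) (trans (a≡rⁿ k) rᵏ≡1)
    open IntegerIndexed {a} rᴺ≡1 a≡rⁿ′

  primitive⇒complete : ∀ {a b} → IsPrimitiveRoot p b → IsPowerSeq p a b → IsComplete p a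
  primitive⇒complete {a} {b} b-primitive (a₊ , a₋) = inverses⇒periodic a₋′ , bounds , surjective
    where
    open PrimitiveRoot b-primitive
    a₊′ : ∀ n → a (+ n) ≡ b ^ n
    a₊′ n = trans (a₊ n) (powF≡^ b n)
    a₋′ : ∀ k → a -[1+ k ] * b ^ suc k ≡ 1#
    a₋′ k = trans (cong (a -[1+ k ] *_) (sym (powF≡^ b (suc k)))) (a₋ k)
    open IntegerIndexed {a} bᴺ≡1 a₊′
    bounds : ∀ i → 1 ≤ i → i ≤ p ∸ 2 → 2 ≤ toℕ (a (+ i))
    bounds i 1≤i i≤p∸2 =
      subst (λ x → 2 ≤ toℕ x) (sym (a₊′ i)) (≢0,1⇒2≤ (^-≢0 b i b≢0) (bᵏ≢1 1≤i (≤p∸2⇒<N i≤p∸2)))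
    surjective : ∀ y → 2 ≤ toℕ y → Σ ℕ λ i → 1 ≤ i × i ≤ p ∸ 2 × a (+ i) ≡ y
    surjective y 2≤y with powers-surjective (2≤⇒≢0 2≤y)
    ... | zero  , _   , b⁰≡y = contradiction (sym b⁰≡y) (2≤⇒≢1 2≤y)
    ... | suc i , i<N , bⁱ≡y = suc i , s≤s z≤n , <N⇒≤p∸2 i<N , trans (a₊′ (suc i)) bⁱ≡y

open import Defs
open import Data.Nat using (ℕ; NonZero; _≤_)
open import Data.Nat.Primality using (Prime)
open import Data.Integer using (ℤ)
open import Data.Product using (Σ; _×_)
open import Function.Bundles using (_⇔_; mk⇔)
import Data.Integer as ℤ

complete⇒powers : (p : ℕ) .{{_ : NonZero p}} → Prime p → 5 ≤ p → FewerThan3Roots p →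
  (a : ℤ → 𝔽 p) → IsΦSeq p 3 a → IsComplete p a →
  Σ (𝔽 p) λ r → IsPadovanRoot p r × (∀ n → a (ℤ.+ n) ≡ powF p r n)
complete⇒powers p p-prime 5≤p fewer a (a₀≡1 , a-padovan) (a-periodic , a-bounds , _) with p ℕₚ.≟ 23
... | yes ≡.refl = ten , ten-root , λ n → ≡.trans (a≡10ⁿ n) (≡.sym (powF≡^ ten n))
  where
  open Padovan23
  open ResidueRing 23 using (_^_; powF≡^)
  a≡10ⁿ : ∀ n → a (ℤ.+ n) ≡ ten ^ n
  a≡10ⁿ = complete⇒powers-of-ten (λ n → a-padovan (ℤ.+ n)) a₀≡1 a-bounds (≡.trans (a-periodic (ℤ.+ 0)) a₀≡1)
... | no p≢23 = powF-form
  (periodic-padovan⇒powers 5≤p p≢23 fewer (λ n → a-periodic (ℤ.+ n)) (λ n → a-padovan (ℤ.+ n)) a₀≡1)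
  where
  open Padovan p p-prime
  open PrimeField p p-prime using (Carrier; _^_; powF≡^)
  powF-form : Σ Carrier (λ r → IsPadovanRoot p r × (∀ n → a (ℤ.+ n) ≡ r ^ n)) →
              Σ (𝔽 p) λ r → IsPadovanRoot p r × (∀ n → a (ℤ.+ n) ≡ powF p r n)
  powF-form (r , r-root , a≡rⁿ) = r , r-root , λ n → ≡.trans (a≡rⁿ n) (≡.sym (powF≡^ r n))

theorem1p2 : (p : ℕ) .{{_ : NonZero p}} → Prime p → 5 ≤ p →
    FewerThan3Roots p →
    (a : ℤ → 𝔽 p) → IsΦSeq p 3 a →
    (IsComplete p a ⇔ Σ (𝔽 p) λ b → IsPadovanPrimitiveRoot p b × IsPowerSeq p a b)
theorem1p2 p p-prime 5≤p fewer a a-Φ@(a₀≡1 , _) = mk⇔ to from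
  where
  open Complete p p-prime
  to : IsComplete p a → Σ (𝔽 p) λ b → IsPadovanPrimitiveRoot p b × IsPowerSeq p a b
  to complete with complete⇒powers p p-prime 5≤p fewer a a-Φ complete
  ... | r , r-root , a≡rⁿ with complete⇒primitive a₀≡1 complete a≡rⁿ
  ...   | r-primitive , a-powers = r , (r-primitive , r-root) , a-powers
  from : (Σ (𝔽 p) λ b → IsPadovanPrimitiveRoot p b × IsPowerSeq p a b) → IsComplete p a
  from (b , (b-primitive , _) , a-powers) = primitive⇒complete b-primitive a-powers
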